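{- Let $\mathcal N$ be a marked graph. If $\mathcal N$ is connected, then its deficiency is either $0$ or $1$. Moreover, $\mathcal N$ has deficiency zero if and only if it is weakly reversible.
   Context: A Petri net is $\mathcal N=(P,T,W^-,W^+)$ with finite disjoint sets $P$ (places) and $T$ (transitions) and matrices $W^-,W^+\in\mathbb N^{P\times T}$; its incidence matrix is $W=W^+-W^-$. The input bag ${}^\bullet t\in\mathbb N^P$ (resp. output bag $t^\bullet$) of a transition $t$ is the column of $W^-$ (resp. $W^+$) indexed by $t$; similarly ${}^\bullet p$, $p^\bullet$ are the rows of $W^+$, $W^-$ indexed by $p$. A marked graph is a Petri net in which every place has exactly one input transition and exactly one output transition. The set of complexes is $\mathcal C=\{{}^\bullet t: t\in T\}\cup\{t^\bullet: t\in T\}$; the reaction graph is the directed graph with node set $\mathcal C$ and arcs $({}^\bullet t,t^\bullet)$, $t\in T$. The net is weakly reversible if every connected component of its reaction graph is strongly connected. If $\ell$ is the number of connected components of the reaction graph, the deficiency of the net is $|\mathcal C|-\ell-\mathrm{rank}(W)$. -}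

module Defs where

open import Data.Nat using (ℕ; zero; suc)
open import Data.Fin using (Fin)
open import Data.Integer using (ℤ; +_; _-_)
open import Data.Rational using (ℚ; 0ℚ; _+_; _*_; _/_)
open import Data.Vec using (Vec; tabulate)
open import Data.Sum using (_⊎_; inj₁; inj₂)
open import Data.Product using (Σ; ∃; ∃-syntax; _×_; _,_)
open import Relation.Nullary using (¬_)
open import Relation.Binary.PropositionalEquality using (_≡_; _≢_)
open import Relation.Binary.Construct.Closure.ReflexiveTransitive using (Star)
open import Relation.Binary.Construct.Closure.Symmetric using (SymClosure)
open import Function.Bundles using (_⇔_)

-- A Petri net with places Fin np and transitions Fin nt;
-- pre = W⁻, post = W⁺ (matrices indexed place × transition).
record PetriNet : Set where
  field
    np nt : ℕ
    pre post : Fin np → Fin nt → ℕ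
open PetriNet public

IsSingletonBag : {n : ℕ} → (Fin n → ℕ) → Set
IsSingletonBag {n} row = ∃[ t ] (row t ≡ 1 × (∀ t' → t' ≢ t → row t' ≡ 0))

-- Marked graph: every place has exactly one input transition (•p = row of W⁺)
-- and exactly one output transition (p• = row of W⁻).
MarkedGraph : PetriNet → Set
MarkedGraph N = ∀ p → IsSingletonBag (post N p) × IsSingletonBag (pre N p)

data NetAdj (N : PetriNet) : Fin (np N) ⊎ Fin (nt N) → Fin (np N) ⊎ Fin (nt N) → Set where
  arc-pre  : ∀ p t → pre N p t ≢ 0 → NetAdj N (inj₁ p) (inj₂ t)
  arc-post : ∀ p t → post N p t ≢ 0 → NetAdj N (inj₂ t) (inj₁ p)

Connected : PetriNet → Set
Connected N = ∀ x y → Star (SymClosure (NetAdj N)) x y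

inBag : (N : PetriNet) → Fin (nt N) → Vec ℕ (np N)
inBag N t = tabulate (λ p → pre N p t)

outBag : (N : PetriNet) → Fin (nt N) → Vec ℕ (np N)
outBag N t = tabulate (λ p → post N p t)

IsComplex : (N : PetriNet) → Vec ℕ (np N) → Set
IsComplex N b = ∃[ t ] (inBag N t ≡ b ⊎ outBag N t ≡ b)

RArc : (N : PetriNet) → Vec ℕ (np N) → Vec ℕ (np N) → Set
RArc N b b' = ∃[ t ] (inBag N t ≡ b × outBag N t ≡ b')

NumComplexes : PetriNet → ℕ → Set
NumComplexes N c =
  Σ (Fin c → Vec ℕ (np N)) λ e →
    (∀ i j → e i ≡ e j → i ≡ j) × (∀ b → IsComplex N b ⇔ (∃[ i ] e i ≡ b))

RConn : (N : PetriNet) → Vec ℕ (np N) → Vec ℕ (np N) → Set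
RConn N = Star (SymClosure (RArc N))

NumLinkageClasses : PetriNet → ℕ → Set
NumLinkageClasses N ℓ =
  Σ ((b : Vec ℕ (np N)) → IsComplex N b → Fin ℓ) λ f →
    (∀ k → ∃[ b ] Σ (IsComplex N b) λ h → f b h ≡ k) ×
    (∀ b h b' h' → (f b h ≡ f b' h') ⇔ RConn N b b')

incidence : (N : PetriNet) → Fin (np N) → Fin (nt N) → ℚ
incidence N p t = (+ post N p t - + pre N p t) / 1

sumℚ : {n : ℕ} → (Fin n → ℚ) → ℚ
sumℚ {zero} f = 0ℚ
sumℚ {suc n} f = f Fin.zero + sumℚ (λ i → f (Fin.suc i))

LinIndepCols : {m n r : ℕ} → (Fin m → Fin n → ℚ) → (Fin r → Fin n) → Set
LinIndepCols {m} {n} {r} A cs =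
  ∀ (a : Fin r → ℚ) → (∀ p → sumℚ (λ i → a i * A p (cs i)) ≡ 0ℚ) → ∀ i → a i ≡ 0ℚ

HasRank : {m n : ℕ} → (Fin m → Fin n → ℚ) → ℕ → Set
HasRank {m} {n} A r =
  (∃[ cs ] LinIndepCols {r = r} A cs) ×
  (∀ (cs : Fin (suc r) → Fin n) → ¬ LinIndepCols A cs)

Deficiency : PetriNet → ℤ → Set
Deficiency N δ = ∃[ c ] ∃[ ℓ ] ∃[ r ]
  (NumComplexes N c × NumLinkageClasses N ℓ × HasRank (incidence N) r ×
   δ ≡ (+ c - + ℓ) - + r)

WeaklyReversible : PetriNet → Set
WeaklyReversible N =
  ∀ b b' → IsComplex N b → RConn N b b' → Star (RArc N) b b'

-- In a marked graph every place p has one producer and one consumer, so the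
-- input complex of a transition t is the set of places consumed by t and its
-- output complex the set of places produced by t. A non-empty complex is
-- therefore the source of at most one reaction and the target of at most one,
-- and every row of the incidence matrix is e(producer p) − e(consumer p); as
-- the net is connected, the incidence matrix has rank |T| − 1.
--
-- If every output complex is also an input complex, following "the reaction
-- consuming my product" from any transition runs into a cycle of the reaction
-- graph; cycles pass from a transition to its neighbours through the places,
-- so every reaction lies on a cycle and the net is weakly reversible. Then the
-- input complexes are pairwise distinct, are all the complexes and are all
-- linked, so |C| = |T|, ℓ = 1 and δ = 0. Otherwise no reaction lies on a
-- directed cycle, so the net is not weakly reversible; by the degree bound an
-- undirected cycle would be directed, so the reaction graph is a forest,
-- |C| = ℓ + |T| and δ = 1.

module Submission where

open import Defs
open import Data.Integer using (ℤ; +_)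
open import Data.Sum using (_⊎_)
open import Data.Product using (_×_)
open import Relation.Binary.PropositionalEquality using (_≡_)
open import Function.Bundles using (_⇔_)

open import Algebra using (AbelianGroup)
open import Data.Fin as Fin using (Fin; toℕ; fromℕ<; punchIn; punchOut; _≟_)
open import Data.Fin.Properties
  using ( any?; all?; pigeonhole; injective⇒≤; cantor-schröder-bernstein; suc-injective
        ; toℕ<n; toℕ-fromℕ<; toℕ-injective; punchOut-injective; punchOut-cong; punchOut-punchIn
        ; punchInᵢ≢i )
import Data.Integer as ℤ
import Data.Integer.Properties as ℤ
open import Data.Integer.Tactic.RingSolver using (solve-∀)
open import Data.Nat as ℕ using (ℕ; zero; suc; _≤′_; ≤′-refl; ≤′-step)
import Data.Nat.Properties as ℕ
open import Data.Nat.GeneralisedArithmetic using (iterate)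
open import Data.Product using (Σ; ∃₂; ∃-syntax; _,_; proj₁; proj₂)
open import Data.Rational as ℚ using (ℚ; 0ℚ; 1ℚ; _*_; _-_; -_; _/_)
import Data.Rational.Properties as ℚ
open import Data.Sum using (inj₁; inj₂)
open import Data.Vec using (Vec; lookup; tabulate)
import Data.Vec.Properties as Vec
open import Data.Vec.Functional using (_∷_)
open import Function using (_∘_; Injective)
open import Function.Bundles using (mk⇔; Equivalence)
open import Function.Properties.Equivalence using (⇔-isEquivalence)
open import Relation.Binary.PropositionalEquality
  using (refl; sym; trans; cong; cong₂; subst; subst₂; _≢_; module ≡-Reasoning)
open import Relation.Binary.Construct.Closure.ReflexiveTransitive as Star using (Star; ε; _◅_; _◅◅_)
open import Relation.Binary.Construct.Closure.Symmetric using (SymClosure; fwd; bwd)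
open import Relation.Binary.Construct.Closure.Equivalence as EqClosure using (EqClosure)
open import Relation.Nullary using (¬_; Dec; yes; no; contradiction)

open import Algebra.Properties.Group (AbelianGroup.group ℚ.+-0-abelianGroup) using (x∙y⁻¹≈ε⇒x≈y)

open Equivalence using (to; from)

private
  variable
    m n : ℕ

uncons : ∀ {A : Set} {R : A → A → Set} {x y} → Star R x y → x ≡ y ⊎ ∃[ w ] (R x w × Star R w y)
uncons ε        = inj₁ refl
uncons (r ◅ rs) = inj₂ (_ , r , rs)

unsnoc : ∀ {A : Set} {R : A → A → Set} {x y} → Star R x y → x ≡ y ⊎ ∃[ w ] (Star R x w × R w y)
unsnoc ε = inj₁ refl
unsnoc (r ◅ rs) with unsnoc rs
... | inj₁ refl           = inj₂ (_ , ε , r)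
... | inj₂ (w , rs′ , r′) = inj₂ (w , r ◅ rs′ , r′)

injective⇒surjective : {f : Fin n → Fin n} → Injective _≡_ _≡_ f → ∀ y → ∃[ x ] f x ≡ y
injective⇒surjective {suc n} {f} f-inj y with any? (λ x → f x ≟ y)
... | yes hit = hit
... | no miss = contradiction (injective⇒≤ g-inj) ℕ.1+n≰n
  where
  missed : ∀ x → y ≢ f x
  missed x y≡fx = miss (x , sym y≡fx)
  g : Fin (suc n) → Fin n
  g x = punchOut (missed x)
  g-inj : Injective _≡_ _≡_ g
  g-inj {x} {x′} eq = f-inj (punchOut-injective (missed x) (missed x′) eq)

identify : {i j : Fin (suc n)} → i ≢ j → Fin (suc n) → Fin n
identify {j = j} i≢j a with a ≟ j
... | yes _  = punchOut (i≢j ∘ sym)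
... | no a≢j = punchOut (a≢j ∘ sym)

module _ {i j : Fin (suc n)} (i≢j : i ≢ j) where

  identify-merges : identify i≢j i ≡ identify i≢j j
  identify-merges with i ≟ j | j ≟ j
  ... | yes i≡j | _      = contradiction i≡j i≢j
  ... | no _    | yes _  = punchOut-cong j refl
  ... | no _    | no j≢j = contradiction refl j≢j

  identify-kernel : ∀ {a b} → identify i≢j a ≡ identify i≢j b →
    a ≡ b ⊎ (a ≡ i ⊎ a ≡ j) × (b ≡ i ⊎ b ≡ j)
  identify-kernel {a} {b} eq with a ≟ j | b ≟ j
  ... | yes a≡j | yes b≡j = inj₁ (trans a≡j (sym b≡j))
  ... | yes a≡j | no b≢j  =
    inj₂ (inj₂ a≡j , inj₁ (sym (punchOut-injective (i≢j ∘ sym) (b≢j ∘ sym) eq)))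
  ... | no a≢j  | yes b≡j =
    inj₂ (inj₁ (punchOut-injective (a≢j ∘ sym) (i≢j ∘ sym) eq) , inj₂ b≡j)
  ... | no a≢j  | no b≢j  = inj₁ (punchOut-injective (a≢j ∘ sym) (b≢j ∘ sym) eq)

  identify-punchIn : ∀ k → identify i≢j (punchIn j k) ≡ k
  identify-punchIn k with punchIn j k ≟ j
  ... | yes j′≡j = contradiction j′≡j (punchInᵢ≢i j k)
  ... | no _     = trans (punchOut-cong j refl) (punchOut-punchIn j)

iterate-+ : ∀ {A : Set} (f : A → A) x m n → iterate f x (m ℕ.+ n) ≡ iterate f (iterate f x m) n
iterate-+ f x zero    n = refl
iterate-+ f x (suc m) n = iterate-+ f (f x) m n

periodicPoint : (f : Fin n → Fin n) → Fin n → ∃₂ λ y k → iterate f y (suc k) ≡ y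
periodicPoint {n} f x
  with i , j , i<j , fⁱx≡fʲx ← pigeonhole (ℕ.n<1+n n) (λ i → iterate f x (toℕ i))
  with k , i+1+k≡j ← ℕ.m≤n⇒∃[o]m+o≡n i<j
  = iterate f x (toℕ i) , k , (begin
      iterate f (iterate f x (toℕ i)) (suc k) ≡⟨ iterate-+ f x (toℕ i) (suc k) ⟨
      iterate f x (toℕ i ℕ.+ suc k)           ≡⟨ cong (iterate f x) (trans (ℕ.+-suc (toℕ i) k) i+1+k≡j) ⟩
      iterate f x (toℕ j)                     ≡⟨ fⁱx≡fʲx ⟨
      iterate f x (toℕ i)                     ∎)
  where open ≡-Reasoning

sumℚ-cong : {f g : Fin n → ℚ} → (∀ k → f k ≡ g k) → sumℚ f ≡ sumℚ g
sumℚ-cong {zero}  f≗g = refl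
sumℚ-cong {suc n} f≗g = cong₂ ℚ._+_ (f≗g Fin.zero) (sumℚ-cong (f≗g ∘ Fin.suc))

sumℚ-zero : {f : Fin n → ℚ} → (∀ k → f k ≡ 0ℚ) → sumℚ f ≡ 0ℚ
sumℚ-zero {zero}  f≡0 = refl
sumℚ-zero {suc n} f≡0 =
  trans (cong₂ ℚ._+_ (f≡0 Fin.zero) (sumℚ-zero (f≡0 ∘ Fin.suc))) (ℚ.+-identityˡ 0ℚ)

sumℚ-single : {f : Fin n → ℚ} (i : Fin n) → (∀ k → k ≢ i → f k ≡ 0ℚ) → sumℚ f ≡ f i
sumℚ-single {suc n} {f} Fin.zero    off =
  trans (cong (f Fin.zero ℚ.+_) (sumℚ-zero (λ k → off (Fin.suc k) λ ()))) (ℚ.+-identityʳ _)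
sumℚ-single {suc n} {f} (Fin.suc i) off =
  trans (cong₂ ℚ._+_ (off Fin.zero λ ())
                     (sumℚ-single i (λ k k≢i → off (Fin.suc k) (k≢i ∘ suc-injective))))
        (ℚ.+-identityˡ _)

sumℚ-pair : {f : Fin n → ℚ} (i j : Fin n) → i ≢ j → (∀ k → k ≢ i → k ≢ j → f k ≡ 0ℚ) →
  sumℚ f ≡ f i ℚ.+ f j
sumℚ-pair         Fin.zero    Fin.zero    i≢j off = contradiction refl i≢j
sumℚ-pair {f = f} Fin.zero    (Fin.suc j) i≢j off =
  cong (f Fin.zero ℚ.+_) (sumℚ-single j (λ k k≢j → off (Fin.suc k) (λ ()) (k≢j ∘ suc-injective)))
sumℚ-pair {f = f} (Fin.suc i) Fin.zero    i≢j off =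
  trans (cong (f Fin.zero ℚ.+_) (sumℚ-single i (λ k k≢i → off (Fin.suc k) (k≢i ∘ suc-injective) (λ ()))))
        (ℚ.+-comm (f Fin.zero) (f (Fin.suc i)))
sumℚ-pair         (Fin.suc i) (Fin.suc j) i≢j off =
  trans (cong₂ ℚ._+_ (off Fin.zero (λ ()) (λ ()))
          (sumℚ-pair i j (i≢j ∘ cong Fin.suc)
            (λ k k≢i k≢j → off (Fin.suc k) (k≢i ∘ suc-injective) (k≢j ∘ suc-injective))))
        (ℚ.+-identityˡ _)

record IsEdgeRow (row : Fin n → ℚ) (u v : Fin n) : Set where
  field
    off       : ∀ k → k ≢ u → k ≢ v → row k ≡ 0ℚ
    at-source : u ≢ v → row u ≡ 1ℚ
    at-target : u ≢ v → row v ≡ - 1ℚ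
    at-loop   : u ≡ v → row u ≡ 0ℚ

module _ {row : Fin n → ℚ} {u v : Fin n} (edge : IsEdgeRow row u v) where
  open IsEdgeRow edge

  edgeRow-combination : ∀ (b : Fin n → ℚ) → sumℚ (λ k → b k * row k) ≡ b u - b v
  edgeRow-combination b with u ≟ v
  ... | yes refl = trans (sumℚ-zero term≡0) (sym (ℚ.+-inverseʳ (b u)))
    where
    term≡0 : ∀ k → b k * row k ≡ 0ℚ
    term≡0 k with k ≟ u
    ... | yes refl = trans (cong (b k *_) (at-loop refl)) (ℚ.*-zeroʳ (b k))
    ... | no k≢u   = trans (cong (b k *_) (off k k≢u k≢u)) (ℚ.*-zeroʳ (b k))
  ... | no u≢v = begin
    sumℚ (λ k → b k * row k)    ≡⟨ sumℚ-pair u v u≢v off-term ⟩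
    b u * row u ℚ.+ b v * row v ≡⟨ cong₂ (λ x y → b u * x ℚ.+ b v * y) (at-source u≢v) (at-target u≢v) ⟩
    b u * 1ℚ ℚ.+ b v * - 1ℚ     ≡⟨ cong₂ ℚ._+_ (ℚ.*-identityʳ (b u)) (sym (ℚ.neg-distribʳ-* (b v) 1ℚ)) ⟩
    b u ℚ.+ - (b v * 1ℚ)        ≡⟨ cong (λ x → b u - x) (ℚ.*-identityʳ (b v)) ⟩
    b u - b v                   ∎
    where
    open ≡-Reasoning
    off-term : ∀ k → k ≢ u → k ≢ v → b k * row k ≡ 0ℚ
    off-term k k≢u k≢v = trans (cong (b k *_) (off k k≢u k≢v)) (ℚ.*-zeroʳ (b k))

  isEdgeRow-∘ : ∀ {m} {cs : Fin m → Fin n} {k₁ k₂} → Injective _≡_ _≡_ cs →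
    cs k₁ ≡ u → cs k₂ ≡ v → IsEdgeRow (row ∘ cs) k₁ k₂
  isEdgeRow-∘ {cs = cs} {k₁} {k₂} cs-inj csk₁≡u csk₂≡v = record
    { off       = λ k k≢k₁ k≢k₂ → off (cs k) (k≢k₁ ∘ cs-inj ∘ λ csk≡u → trans csk≡u (sym csk₁≡u))
                                             (k≢k₂ ∘ cs-inj ∘ λ csk≡v → trans csk≡v (sym csk₂≡v))
    ; at-source = λ k₁≢k₂ → trans (cong row csk₁≡u) (at-source (k₁≢k₂ ∘ k₁≡k₂))
    ; at-target = λ k₁≢k₂ → trans (cong row csk₂≡v) (at-target (k₁≢k₂ ∘ k₁≡k₂))
    ; at-loop   = λ k₁≡k₂ → trans (cong row csk₁≡u)
                                  (at-loop (trans (sym csk₁≡u) (trans (cong cs k₁≡k₂) csk₂≡v)))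
    }
    where
    k₁≡k₂ : u ≡ v → k₁ ≡ k₂
    k₁≡k₂ u≡v = cs-inj (trans csk₁≡u (trans u≡v (sym csk₂≡v)))

edgeVector : Fin n → Fin n → Fin n → ℚ
edgeVector u v k with k ≟ u | k ≟ v
... | yes _ | yes _ = 0ℚ
... | yes _ | no _  = 1ℚ
... | no _  | yes _ = - 1ℚ
... | no _  | no _  = 0ℚ

edgeVector-isEdgeRow : (u v : Fin n) → IsEdgeRow (edgeVector u v) u v
edgeVector-isEdgeRow u v =
  record { off = off ; at-source = at-source ; at-target = at-target ; at-loop = at-loop }
  where
  off : ∀ k → k ≢ u → k ≢ v → edgeVector u v k ≡ 0ℚ
  off k k≢u k≢v with k ≟ u | k ≟ v
  ... | yes k≡u | _       = contradiction k≡u k≢u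
  ... | no _    | yes k≡v = contradiction k≡v k≢v
  ... | no _    | no _    = refl
  at-source : u ≢ v → edgeVector u v u ≡ 1ℚ
  at-source u≢v with u ≟ u | u ≟ v
  ... | no u≢u | _       = contradiction refl u≢u
  ... | yes _  | yes u≡v = contradiction u≡v u≢v
  ... | yes _  | no _    = refl
  at-target : u ≢ v → edgeVector u v v ≡ - 1ℚ
  at-target u≢v with v ≟ u | v ≟ v
  ... | yes v≡u | _      = contradiction (sym v≡u) u≢v
  ... | no _    | no v≢v = contradiction refl v≢v
  ... | no _    | yes _  = refl
  at-loop : u ≡ v → edgeVector u v u ≡ 0ℚ
  at-loop refl with u ≟ u
  ... | yes _  = refl
  ... | no u≢u = contradiction refl u≢u

module _ {m n : ℕ} {A : Fin m → Fin n → ℚ} where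

  LinIndepCols⇒injective : ∀ {r} {cs : Fin r → Fin n} → LinIndepCols A cs → Injective _≡_ _≡_ cs
  LinIndepCols⇒injective {cs = cs} indep {i} {j} csᵢ≡csⱼ with i ≟ j
  ... | yes i≡j = i≡j
  ... | no i≢j  =
    contradiction (trans (sym (at-source i≢j)) (indep (edgeVector i j) combination≡0 i)) λ ()
    where
    open IsEdgeRow (edgeVector-isEdgeRow i j)
    combination≡0 : ∀ p → sumℚ (λ k → edgeVector i j k * A p (cs k)) ≡ 0ℚ
    combination≡0 p = begin
      sumℚ (λ k → edgeVector i j k * A p (cs k)) ≡⟨ sumℚ-cong (λ k → ℚ.*-comm (edgeVector i j k) _) ⟩
      sumℚ (λ k → A p (cs k) * edgeVector i j k) ≡⟨ edgeRow-combination (edgeVector-isEdgeRow i j) (A p ∘ cs) ⟩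
      A p (cs i) - A p (cs j)                    ≡⟨ cong (λ c → A p (cs i) - A p c) csᵢ≡csⱼ ⟨
      A p (cs i) - A p (cs i)                    ≡⟨ ℚ.+-inverseʳ (A p (cs i)) ⟩
      0ℚ                                         ∎
      where open ≡-Reasoning

  LinIndepCols-tail : ∀ {r} {cs : Fin (suc r) → Fin n} → LinIndepCols A cs → LinIndepCols A (cs ∘ Fin.suc)
  LinIndepCols-tail {cs = cs} indep a combination≡0 i = indep (0ℚ ∷ a) extended≡0 (Fin.suc i)
    where
    extended≡0 : ∀ p → sumℚ (λ k → (0ℚ ∷ a) k * A p (cs k)) ≡ 0ℚ
    extended≡0 p = trans (cong (ℚ._+ rest) (ℚ.*-zeroˡ (A p (cs Fin.zero))))
                         (trans (ℚ.+-identityˡ rest) (combination≡0 p))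
      where
      rest : ℚ
      rest = sumℚ (λ k → a k * A p (cs (Fin.suc k)))

  LinIndepCols-shrink : ∀ {r r′} {cs : Fin r → Fin n} → r′ ≤′ r → LinIndepCols A cs →
    ∃[ cs′ ] LinIndepCols {r = r′} A cs′
  LinIndepCols-shrink ≤′-refl indep = _ , indep
  LinIndepCols-shrink {cs = cs} (≤′-step r′≤′r) indep =
    LinIndepCols-shrink r′≤′r (LinIndepCols-tail {cs = cs} indep)

  LinIndepCols⇒≤rank : ∀ {r r′} {cs : Fin r′ → Fin n} → HasRank A r → LinIndepCols A cs → r′ ℕ.≤ r
  LinIndepCols⇒≤rank {r} {r′} (_ , maximal) indep with r′ ℕ.≤? r
  ... | yes r′≤r = r′≤r
  ... | no r′≰r
    with cs′ , indep′ ← LinIndepCols-shrink (ℕ.≤⇒≤′ (ℕ.≰⇒> r′≰r)) indep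
    = contradiction indep′ (maximal cs′)

  HasRank-unique : ∀ {r r′} → HasRank A r → HasRank A r′ → r ≡ r′
  HasRank-unique ρ ρ′ =
    ℕ.≤-antisym (LinIndepCols⇒≤rank ρ′ (proj₂ (proj₁ ρ))) (LinIndepCols⇒≤rank ρ (proj₂ (proj₁ ρ′)))

  HasRank⇒≤columns : ∀ {r} → HasRank A r → r ℕ.≤ n
  HasRank⇒≤columns ((_ , indep) , _) = injective⇒≤ (LinIndepCols⇒injective indep)

module _ {m n : ℕ} {A : Fin m → Fin (suc n) → ℚ} {u v : Fin m → Fin (suc n)}
         (rows : ∀ p → IsEdgeRow (A p) (u p) (v p))
         (connected : ∀ (b : Fin (suc n) → ℚ) → (∀ p → b (u p) ≡ b (v p)) → ∀ t t′ → b t ≡ b t′)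
         where

  -- A combination a of the columns other than 0 is the combination 0 ∷ a of
  -- all columns, which vanishes only if 0 ∷ a is constant along the edges.
  incidence-tail-independent : LinIndepCols A Fin.suc
  incidence-tail-independent a combination≡0 i = connected b b-along-edges (Fin.suc i) Fin.zero
    where
    b : Fin (suc n) → ℚ
    b = 0ℚ ∷ a
    b-along-edges : ∀ p → b (u p) ≡ b (v p)
    b-along-edges p = x∙y⁻¹≈ε⇒x≈y (b (u p)) (b (v p)) (begin
      b (u p) - b (v p)          ≡⟨ edgeRow-combination (rows p) b ⟨
      0ℚ * A p Fin.zero ℚ.+ rest ≡⟨ cong (ℚ._+ rest) (ℚ.*-zeroˡ (A p Fin.zero)) ⟩
      0ℚ ℚ.+ rest                ≡⟨ ℚ.+-identityˡ rest ⟩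
      rest                       ≡⟨ combination≡0 p ⟩
      0ℚ                         ∎)
      where
      open ≡-Reasoning
      rest : ℚ
      rest = sumℚ (λ k → a k * A p (Fin.suc k))

  -- suc n independent columns are all the columns, and every row sums to 0.
  incidence-full-dependent : (cs : Fin (suc n) → Fin (suc n)) → ¬ LinIndepCols A cs
  incidence-full-dependent cs indep = contradiction (indep (λ _ → 1ℚ) all-ones≡0 Fin.zero) λ ()
    where
    cs-inj : Injective _≡_ _≡_ cs
    cs-inj = LinIndepCols⇒injective {A = A} indep
    all-ones≡0 : ∀ p → sumℚ (λ k → 1ℚ * A p (cs k)) ≡ 0ℚ
    all-ones≡0 p = trans
      (edgeRow-combination
        (isEdgeRow-∘ (rows p) cs-inj (proj₂ (injective⇒surjective cs-inj (u p)))
                                     (proj₂ (injective⇒surjective cs-inj (v p))))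
        (λ _ → 1ℚ))
      (ℚ.+-inverseʳ 1ℚ)

  connected-incidence-rank : HasRank A n
  connected-incidence-rank = (Fin.suc , incidence-tail-independent) , incidence-full-dependent

module EdgeGraph {A : Set} {e : ℕ} (source target : Fin e → A) where

  Arc : A → A → Set
  Arc x y = ∃[ k ] (source k ≡ x × target k ≡ y)

  Arc[_] : (Fin e → Set) → A → A → Set
  Arc[ P ] x y = ∃[ k ] (P k × source k ≡ x × target k ≡ y)

  Vertex : A → Set
  Vertex x = ∃[ k ] (source k ≡ x ⊎ target k ≡ x)

  OnCycle : Fin e → Set
  OnCycle k = Star Arc (target k) (source k)

  Acyclic : Set
  Acyclic = ∀ t → ¬ EqClosure Arc[ _≢ t ] (source t) (target t)

  -- For the reaction graph of a net, NumComplexes is Enumeration and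
  -- NumLinkageClasses is Partition (EqClosure Arc), definitionally.
  Enumeration : ℕ → Set
  Enumeration c =
    Σ (Fin c → A) λ v → (∀ i j → v i ≡ v j → i ≡ j) × (∀ x → Vertex x ⇔ (∃[ i ] v i ≡ x))

  Partition : (A → A → Set) → ℕ → Set
  Partition R m =
    Σ ((x : A) → Vertex x → Fin m) λ f →
      (∀ k → ∃[ x ] Σ (Vertex x) λ h → f x h ≡ k) ×
      (∀ x h y h′ → (f x h ≡ f y h′) ⇔ R x y)

  arc : ∀ k → Arc (source k) (target k)
  arc k = k , refl , refl

  OnCycle-next : ∀ {t k} → (∀ {k′} → source k′ ≡ target t → k′ ≡ k) → OnCycle t → OnCycle k
  OnCycle-next {t} only-k cycle with uncons cycle
  ... | inj₁ tgt≡src = subst OnCycle (only-k (sym tgt≡src)) cycle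
  ... | inj₂ (_ , (k′ , src≡tgt , refl) , rest) with refl ← only-k src≡tgt =
    subst (Star Arc (target k′)) (sym src≡tgt) (rest ◅◅ (arc t ◅ ε))

  OnCycle-prev : ∀ {t k} → (∀ {k′} → target k′ ≡ source t → k′ ≡ k) → OnCycle t → OnCycle k
  OnCycle-prev {t} only-k cycle with unsnoc cycle
  ... | inj₁ tgt≡src = subst OnCycle (only-k tgt≡src) cycle
  ... | inj₂ (_ , front , (k′ , refl , tgt≡src)) with refl ← only-k tgt≡src =
    subst (λ x → Star Arc x (source k′)) (sym tgt≡src) (arc t ◅ front)

  everyOnCycle⇒stronglyConnected : (∀ k → OnCycle k) → ∀ {x y} → EqClosure Arc x y → Star Arc x y
  everyOnCycle⇒stronglyConnected cycle ε                              = ε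
  everyOnCycle⇒stronglyConnected cycle (fwd a ◅ rest)                 =
    a ◅ everyOnCycle⇒stronglyConnected cycle rest
  everyOnCycle⇒stronglyConnected cycle (bwd (k , refl , refl) ◅ rest) =
    cycle k ◅◅ everyOnCycle⇒stronglyConnected cycle rest

  -- A backward step along an arc k retraces the last arc of the path, which
  -- also enters target k, unless that vertex is z.
  module _ (z : A) (target-unique : ∀ {k k′} → target k ≡ target k′ → k ≡ k′ ⊎ target k ≡ z) where

    extendPath : ∀ {t x y} → Star Arc (target t) x → EqClosure Arc[ _≢ t ] x y →
      Star Arc (target t) y ⊎ Star Arc (target t) z
    extendPath path ε = inj₁ path
    extendPath path (fwd (k , _ , refl , refl) ◅ rest) = extendPath (path ◅◅ (arc k ◅ ε)) rest
    extendPath {t} path (bwd (k , k≢t , refl , refl) ◅ rest) with unsnoc path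
    ... | inj₁ tgt-t≡tgt-k with target-unique tgt-t≡tgt-k
    ...   | inj₁ t≡k     = contradiction (sym t≡k) k≢t
    ...   | inj₂ tgt-t≡z = inj₂ (subst (Star Arc (target t)) tgt-t≡z ε)
    extendPath {t} path (bwd (k , k≢t , refl , refl) ◅ rest) | inj₂ (_ , front , (k′ , refl , tgt≡tgt))
      with target-unique tgt≡tgt
    ... | inj₁ refl      = extendPath front rest
    ... | inj₂ tgt-k′≡z  = inj₂ (subst (Star Arc (target t)) (trans (sym tgt≡tgt) tgt-k′≡z) path)

  module _ {R : A → A → Set} where

    classMap : ∀ {m m′} → Partition R m → Partition R m′ → Fin m → Fin m′
    classMap (_ , f-surj , _) (g , _ , _) k = g (proj₁ (f-surj k)) (proj₁ (proj₂ (f-surj k)))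

    classMap-injective : ∀ {m m′} (P : Partition R m) (Q : Partition R m′) →
      Injective _≡_ _≡_ (classMap P Q)
    classMap-injective (f , f-surj , f-ker) (g , _ , g-ker) {k} {k′} gx≡gx′
      with x , h , refl ← f-surj k | x′ , h′ , refl ← f-surj k′ =
      from (f-ker x h x′ h′) (to (g-ker x h x′ h′) gx≡gx′)

    partition-unique : ∀ {m m′} → Partition R m → Partition R m′ → m ≡ m′
    partition-unique P Q = cantor-schröder-bernstein (classMap-injective P Q) (classMap-injective Q P)

    partition-cong : ∀ {R′ m} → (∀ {x y} → R x y → R′ x y) → (∀ {x y} → R′ x y → R x y) →
      Partition R m → Partition R′ m
    partition-cong R⇒R′ R′⇒R (f , f-surj , f-ker) =
      f , f-surj , λ x h y h′ → mk⇔ (R⇒R′ ∘ to (f-ker x h y h′)) (from (f-ker x h y h′) ∘ R′⇒R)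

    partition-connected : ∀ {ℓ x} → Partition R ℓ → Vertex x → (∀ y → Vertex y → R x y) → ℓ ≡ 1
    partition-connected {x = x} (f , f-surj , f-ker) hx x-reaches =
      cantor-schröder-bernstein {f = λ _ → Fin.zero} {g = λ _ → f x hx}
        collapse-injective λ { {Fin.zero} {Fin.zero} _ → refl }
      where
      class-of-x : ∀ k → k ≡ f x hx
      class-of-x k with y , hy , refl ← f-surj k = sym (from (f-ker x hx y hy) (x-reaches y hy))
      collapse-injective : ∀ {k k′} → Fin.zero ≡ Fin.zero → k ≡ k′
      collapse-injective {k} {k′} _ = trans (class-of-x k) (sym (class-of-x k′))

  discrete-partition : ∀ {c} → Enumeration c → Partition _≡_ c
  discrete-partition {c} (v , v-inj , v-enum) = f , f-surj , f-ker
    where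
    f : (x : A) → Vertex x → Fin c
    f x h = proj₁ (to (v-enum x) h)
    f-index : ∀ {x} (h : Vertex x) → v (f x h) ≡ x
    f-index {x} h = proj₂ (to (v-enum x) h)
    f-surj : ∀ i → ∃[ x ] Σ (Vertex x) λ h → f x h ≡ i
    f-surj i = v i , hᵢ , v-inj _ i (f-index hᵢ)
      where
      hᵢ : Vertex (v i)
      hᵢ = from (v-enum (v i)) (i , refl)
    f-ker : ∀ x h y h′ → (f x h ≡ f y h′) ⇔ x ≡ y
    f-ker x h y h′ = mk⇔
      (λ eq → trans (sym (f-index h)) (trans (cong v eq) (f-index h′)))
      (λ { refl → v-inj _ _ (trans (f-index h) (sym (f-index h′))) })

  enumeration-size : ∀ {c n} → Enumeration c → (w : Fin n → A) → (∀ k → Vertex (w k)) →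
    Injective _≡_ _≡_ w → (∀ x → Vertex x → ∃[ k ] w k ≡ x) → c ≡ n
  enumeration-size {c} {n} (v , v-inj , v-enum) w w-vertex w-inj w-onto =
    cantor-schröder-bernstein {f = index-in-w} {g = index-in-v} index-in-w-injective index-in-v-injective
    where
    index-in-w : Fin c → Fin n
    index-in-w i = proj₁ (w-onto (v i) (from (v-enum (v i)) (i , refl)))
    index-in-v : Fin n → Fin c
    index-in-v k = proj₁ (to (v-enum (w k)) (w-vertex k))
    index-in-w-injective : Injective _≡_ _≡_ index-in-w
    index-in-w-injective {i} {j} eq =
      v-inj i j (trans (sym (proj₂ (w-onto (v i) _))) (trans (cong w eq) (proj₂ (w-onto (v j) _))))
    index-in-v-injective : Injective _≡_ _≡_ index-in-v
    index-in-v-injective {k} {k′} eq = w-inj (trans (sym (proj₂ (to (v-enum (w k)) (w-vertex k))))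
                                              (trans (cong v eq) (proj₂ (to (v-enum (w k′)) (w-vertex k′)))))

  -- Q is P together with the arc t; the classes of its endpoints merge.
  partition-join : ∀ {P Q : Fin e → Set} {m} t → Q t → (∀ {k} → P k → Q k) →
    (∀ {k} → Q k → P k ⊎ k ≡ t) → ¬ EqClosure Arc[ P ] (source t) (target t) →
    Partition (EqClosure Arc[ P ]) (suc m) → Partition (EqClosure Arc[ Q ]) m
  partition-join {P} {Q} {m} t Qt P⇒Q Q⇒P⊎t bridge (f , f-surj , f-ker) = g , g-surj , g-ker
    where
    hx : Vertex (source t)
    hx = t , inj₁ refl
    hy : Vertex (target t)
    hy = t , inj₂ refl
    i≢j : f (source t) hx ≢ f (target t) hy
    i≢j = bridge ∘ to (f-ker _ hx _ hy)

    g : (x : A) → Vertex x → Fin m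
    g x h = identify i≢j (f x h)

    widen : ∀ {x y} → EqClosure Arc[ P ] x y → EqClosure Arc[ Q ] x y
    widen = EqClosure.map λ (k , Pk , eqs) → k , P⇒Q Pk , eqs

    same-class : ∀ {x} h h′ → f x h ≡ f x h′
    same-class h h′ = from (f-ker _ h _ h′) ε

    joined-to-source : ∀ {x} h → f x h ≡ f (source t) hx ⊎ f x h ≡ f (target t) hy →
      EqClosure Arc[ Q ] x (source t)
    joined-to-source h (inj₁ eq) = widen (to (f-ker _ h _ hx) eq)
    joined-to-source h (inj₂ eq) = widen (to (f-ker _ h _ hy) eq) ◅◅ (bwd (t , Qt , refl , refl) ◅ ε)

    g-surj : ∀ k → ∃[ x ] Σ (Vertex x) λ h → g x h ≡ k
    g-surj k with x , h , fx≡ ← f-surj (punchIn (f (target t) hy) k) =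
      x , h , trans (cong (identify i≢j) fx≡) (identify-punchIn i≢j k)

    g-arc : ∀ {x y} h h′ → Arc[ Q ] x y → g x h ≡ g y h′
    g-arc h h′ (k , Qk , eqs) with Q⇒P⊎t Qk
    ... | inj₁ Pk = cong (identify i≢j) (from (f-ker _ h _ h′) (fwd (k , Pk , eqs) ◅ ε))
    ... | inj₂ refl with refl , refl ← eqs =
      trans (cong (identify i≢j) (same-class h hx))
            (trans (identify-merges i≢j) (cong (identify i≢j) (same-class hy h′)))

    g-path : ∀ {x y} h h′ → EqClosure Arc[ Q ] x y → g x h ≡ g y h′
    g-path h h′ ε = cong (identify i≢j) (same-class h h′)
    g-path h h′ (fwd a@(k , _ , _ , tk) ◅ rest) = trans (g-arc h (k , inj₂ tk) a) (g-path _ h′ rest)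
    g-path h h′ (bwd a@(k , _ , sk , _) ◅ rest) = trans (sym (g-arc (k , inj₁ sk) h a)) (g-path _ h′ rest)

    g-ker : ∀ x h y h′ → (g x h ≡ g y h′) ⇔ EqClosure Arc[ Q ] x y
    g-ker x h y h′ = mk⇔ joined (g-path h h′)
      where
      joined : g x h ≡ g y h′ → EqClosure Arc[ Q ] x y
      joined gx≡gy with identify-kernel i≢j gx≡gy
      ... | inj₁ fx≡fy = widen (to (f-ker x h y h′) fx≡fy)
      ... | inj₂ (x-joined , y-joined) =
        joined-to-source h x-joined ◅◅ EqClosure.symmetric _ (joined-to-source h′ y-joined)

  Below : ℕ → Fin e → Set
  Below n k = toℕ k ℕ.< n

  -- Adding the arcs one at a time, each one joins two classes.
  acyclic-partition : ∀ {c} → Acyclic → Enumeration c → ∀ n → n ℕ.≤ e →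
    ∃[ m ] (Partition (EqClosure Arc[ Below n ]) m × m ℕ.+ n ≡ c)
  acyclic-partition {c} acyclic enum zero _ =
    c , partition-cong (λ { refl → ε }) no-arcs (discrete-partition enum) , ℕ.+-identityʳ c
    where
    no-arcs : ∀ {x y} → EqClosure Arc[ Below 0 ] x y → x ≡ y
    no-arcs ε                      = refl
    no-arcs (fwd (_ , () , _) ◅ _)
    no-arcs (bwd (_ , () , _) ◅ _)
  acyclic-partition acyclic enum (suc n) n<e with acyclic-partition acyclic enum n (ℕ.<⇒≤ n<e)
  ... | zero  , (f , _) , _ = contradiction (f _ (fromℕ< n<e , inj₁ refl)) λ ()
  ... | suc m , part , m+1+n≡c =
    m , partition-join t t-below ℕ.m<n⇒m<1+n split bridge part , trans (ℕ.+-suc m n) m+1+n≡c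
    where
    t : Fin e
    t = fromℕ< n<e
    toℕt≡n : toℕ t ≡ n
    toℕt≡n = toℕ-fromℕ< n<e
    t-below : Below (suc n) t
    t-below = ℕ.≤-reflexive (cong suc toℕt≡n)
    split : ∀ {k} → Below (suc n) k → Below n k ⊎ k ≡ t
    split k<1+n with ℕ.m<1+n⇒m<n∨m≡n k<1+n
    ... | inj₁ k<n = inj₁ k<n
    ... | inj₂ k≡n = inj₂ (toℕ-injective (trans k≡n (sym toℕt≡n)))
    bridge : ¬ EqClosure Arc[ Below n ] (source t) (target t)
    bridge = acyclic t ∘ EqClosure.map λ (k , k<n , eqs) →
      k , (λ k≡t → ℕ.<-irrefl (trans (cong toℕ k≡t) toℕt≡n) k<n) , eqs

  acyclic⇒components+arcs≡vertices : ∀ {c ℓ} → Acyclic → Enumeration c →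
    Partition (EqClosure Arc) ℓ → ℓ ℕ.+ e ≡ c
  acyclic⇒components+arcs≡vertices acyclic enum components
    with m , part , m+e≡c ← acyclic-partition acyclic enum e ℕ.≤-refl =
    trans (cong (ℕ._+ e) (partition-unique components (partition-cong all-below any-below part))) m+e≡c
    where
    all-below : ∀ {x y} → EqClosure Arc[ Below e ] x y → EqClosure Arc x y
    all-below = EqClosure.map λ (k , _ , eqs) → k , eqs
    any-below : ∀ {x y} → EqClosure Arc x y → EqClosure Arc[ Below e ] x y
    any-below = EqClosure.map λ (k , eqs) → k , toℕ<n k , eqs

module _ {A : Set} {e : ℕ} {source target : Fin e → A} where
  open EdgeGraph source target
  private module Reversed = EdgeGraph target source

  private
    reverse-arc : ∀ {x y} → Reversed.Arc x y → Arc y x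
    reverse-arc (k , tk , sk) = k , sk , tk

    reverse-step : ∀ {t x y} → SymClosure Arc[ _≢ t ] x y → SymClosure Reversed.Arc[ _≢ t ] x y
    reverse-step (fwd (k , k≢t , sk , tk)) = bwd (k , k≢t , tk , sk)
    reverse-step (bwd (k , k≢t , sk , tk)) = fwd (k , k≢t , tk , sk)

  -- The walk is followed from both ends; either direction closes the cycle
  -- or reaches z, and then the two halves meet there.
  undirectedCycle⇒OnCycle : (z : A) →
    (∀ {k k′} → source k ≡ source k′ → k ≡ k′ ⊎ source k ≡ z) →
    (∀ {k k′} → target k ≡ target k′ → k ≡ k′ ⊎ target k ≡ z) →
    ∀ {t} → EqClosure Arc[ _≢ t ] (source t) (target t) → OnCycle t
  undirectedCycle⇒OnCycle z source-unique target-unique {t} walk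
    with extendPath z target-unique ε (EqClosure.symmetric _ walk)
       | Reversed.extendPath z source-unique ε (Star.map reverse-step walk)
  ... | inj₁ cycle | _                   = cycle
  ... | inj₂ _     | inj₁ reversed-cycle = Star.reverse reverse-arc reversed-cycle
  ... | inj₂ to-z  | inj₂ reversed-to-z  = to-z ◅◅ Star.reverse reverse-arc reversed-to-z

module _ {n : ℕ} {row : Fin n → ℕ} (s : IsSingletonBag row) where

  singleton-at : row (proj₁ s) ≡ 1
  singleton-at = proj₁ (proj₂ s)

  singleton-off : ∀ t → t ≢ proj₁ s → row t ≡ 0
  singleton-off = proj₂ (proj₂ s)

  singleton-unique : ∀ {t} → row t ≢ 0 → t ≡ proj₁ s
  singleton-unique {t} row-t≢0 with t ≟ proj₁ s
  ... | yes t≡t₀ = t≡t₀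
  ... | no t≢t₀  = contradiction (singleton-off t t≢t₀) row-t≢0

_∈ᵇ_ : Fin n → Vec ℕ n → Set
p ∈ᵇ b = lookup b p ≢ 0

emptyBag : Vec ℕ n
emptyBag = tabulate λ _ → 0

module ConnectedMarkedGraph (N : PetriNet) (mg : MarkedGraph N) (conn : Connected N) where

  private
    P T : Set
    P = Fin (np N)
    T = Fin (nt N)

  producer : P → T
  producer p = proj₁ (proj₁ (mg p))

  consumer : P → T
  consumer p = proj₁ (proj₂ (mg p))

  Feeds : T → T → Set
  Feeds u v = ∃[ p ] (producer p ≡ u × consumer p ≡ v)

  ∈inBag⇒consumer : ∀ {p t} → p ∈ᵇ inBag N t → consumer p ≡ t
  ∈inBag⇒consumer {p} p∈ = sym (singleton-unique (proj₂ (mg p)) (p∈ ∘ trans (Vec.lookup∘tabulate _ p)))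

  ∈outBag⇒producer : ∀ {p t} → p ∈ᵇ outBag N t → producer p ≡ t
  ∈outBag⇒producer {p} p∈ = sym (singleton-unique (proj₁ (mg p)) (p∈ ∘ trans (Vec.lookup∘tabulate _ p)))

  consumer⇒∈inBag : ∀ {p t} → consumer p ≡ t → p ∈ᵇ inBag N t
  consumer⇒∈inBag {p} refl p∉ =
    ℕ.1+n≢0 (trans (sym (singleton-at (proj₂ (mg p)))) (trans (sym (Vec.lookup∘tabulate _ p)) p∉))

  producer⇒∈outBag : ∀ {p t} → producer p ≡ t → p ∈ᵇ outBag N t
  producer⇒∈outBag {p} refl p∉ =
    ℕ.1+n≢0 (trans (sym (singleton-at (proj₁ (mg p)))) (trans (sym (Vec.lookup∘tabulate _ p)) p∉))

  inBag-unique : ∀ {k k′} → inBag N k ≡ inBag N k′ → k ≡ k′ ⊎ inBag N k ≡ emptyBag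
  inBag-unique {k} eq with any? (λ p → consumer p ≟ k)
  ... | yes (p , refl) = inj₁ (∈inBag⇒consumer (subst (p ∈ᵇ_) eq (consumer⇒∈inBag refl)))
  ... | no none        =
    inj₂ (Vec.tabulate-cong λ p → singleton-off (proj₂ (mg p)) k (none ∘ (p ,_) ∘ sym))

  outBag-unique : ∀ {k k′} → outBag N k ≡ outBag N k′ → k ≡ k′ ⊎ outBag N k ≡ emptyBag
  outBag-unique {k} eq with any? (λ p → producer p ≟ k)
  ... | yes (p , refl) = inj₁ (∈outBag⇒producer (subst (p ∈ᵇ_) eq (producer⇒∈outBag refl)))
  ... | no none        =
    inj₂ (Vec.tabulate-cong λ p → singleton-off (proj₁ (mg p)) k (none ∘ (p ,_) ∘ sym))

  placeClosed⇒universal : (Pr : T → Set) → (∀ p → Pr (producer p) → Pr (consumer p)) →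
    (∀ p → Pr (consumer p) → Pr (producer p)) → ∀ {t₀} → Pr t₀ → ∀ t → Pr t
  placeClosed⇒universal Pr forward backward {t₀} Pr-t₀ t =
    to (EqClosure.gfold ⇔-isEquivalence Holds adjacent (conn (inj₂ t₀) (inj₂ t))) Pr-t₀
    where
    Holds : P ⊎ T → Set
    Holds (inj₁ p) = Pr (producer p) × Pr (consumer p)
    Holds (inj₂ t) = Pr t
    adjacent : ∀ {x y} → NetAdj N x y → Holds x ⇔ Holds y
    adjacent (arc-pre p t pre≢0) with refl ← singleton-unique (proj₂ (mg p)) pre≢0 =
      mk⇔ proj₂ (λ Pr-c → backward p Pr-c , Pr-c)
    adjacent (arc-post p t post≢0) with refl ← singleton-unique (proj₁ (mg p)) post≢0 =
      mk⇔ (λ Pr-s → Pr-s , forward p Pr-s) proj₁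

  open EdgeGraph (inBag N) (outBag N)

  OutputsAreInputs : Set
  OutputsAreInputs = ∀ t → ∃[ v ] outBag N t ≡ inBag N v

  outputsAreInputs? : Dec OutputsAreInputs
  outputsAreInputs? = all? λ t → any? λ v → Vec.≡-dec ℕ._≟_ (outBag N t) (inBag N v)

  OnCycle-producer⇒consumer : ∀ p → OnCycle (producer p) → OnCycle (consumer p)
  OnCycle-producer⇒consumer p = OnCycle-next λ inBag≡outBag →
    sym (∈inBag⇒consumer (subst (p ∈ᵇ_) (sym inBag≡outBag) (producer⇒∈outBag refl)))

  OnCycle-consumer⇒producer : ∀ p → OnCycle (consumer p) → OnCycle (producer p)
  OnCycle-consumer⇒producer p = OnCycle-prev λ outBag≡inBag →
    sym (∈outBag⇒producer (subst (p ∈ᵇ_) (sym outBag≡inBag) (consumer⇒∈inBag refl)))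

  OnCycle⇒everyOnCycle : ∀ {t} → OnCycle t → ∀ u → OnCycle u
  OnCycle⇒everyOnCycle =
    placeClosed⇒universal OnCycle OnCycle-producer⇒consumer OnCycle-consumer⇒producer

  OnCycle⇒outputIsInput : ∀ {t} → OnCycle t → ∃[ v ] outBag N t ≡ inBag N v
  OnCycle⇒outputIsInput {t} cycle with uncons cycle
  ... | inj₁ out≡in                     = t , out≡in
  ... | inj₂ (_ , (v , in≡out , _) , _) = v , sym in≡out

  weaklyReversible⇒everyOnCycle : WeaklyReversible N → ∀ t → OnCycle t
  weaklyReversible⇒everyOnCycle reversible t =
    reversible (outBag N t) (inBag N t) (t , inj₂ refl) (bwd (arc t) ◅ ε)

  module _ (outputsAreInputs : OutputsAreInputs) where

    next : T → T
    next t = proj₁ (outputsAreInputs t)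

    outBag≡inBag-next : ∀ t → outBag N t ≡ inBag N (next t)
    outBag≡inBag-next t = proj₂ (outputsAreInputs t)

    iterate-path : ∀ x m → Star Arc (inBag N x) (inBag N (iterate next x m))
    iterate-path x zero    = ε
    iterate-path x (suc m) = (x , refl , outBag≡inBag-next x) ◅ iterate-path (next x) m

    outputsAreInputs⇒everyOnCycle : ∀ t → OnCycle t
    outputsAreInputs⇒everyOnCycle t with y , k , periodic ← periodicPoint next t =
      OnCycle⇒everyOnCycle (subst₂ (Star Arc) (sym (outBag≡inBag-next y)) (cong (inBag N) periodic)
                                               (iterate-path (next y) k)) t

    outBag-producer≡inBag-consumer : ∀ p → outBag N (producer p) ≡ inBag N (consumer p)
    outBag-producer≡inBag-consumer p =
      subst (λ v → outBag N (producer p) ≡ inBag N v) (sym consumer≡next) (outBag≡inBag-next (producer p))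
      where
      consumer≡next : consumer p ≡ next (producer p)
      consumer≡next =
        ∈inBag⇒consumer (subst (p ∈ᵇ_) (outBag≡inBag-next (producer p)) (producer⇒∈outBag refl))

    -- Places leaving one transition all enter the same transition, so every
    -- transition is downstream of an input-free one.
    inputFree⇒feedsAll : ∀ {t} → (∀ p → consumer p ≢ t) → ∀ u → Star Feeds t u
    inputFree⇒feedsAll {t} t-inputFree =
      placeClosed⇒universal (Star Feeds t) (λ p path → path ◅◅ ((p , refl , refl) ◅ ε)) upstream ε
      where
      upstream : ∀ p → Star Feeds t (consumer p) → Star Feeds t (producer p)
      upstream p path with unsnoc path
      ... | inj₁ t≡consumer = contradiction (sym t≡consumer) (t-inputFree p)
      ... | inj₂ (_ , front , (q , refl , consumer-q≡consumer-p)) =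
        subst (Star Feeds t) (sym producer-p≡producer-q) front
        where
        producer-p≡producer-q : producer p ≡ producer q
        producer-p≡producer-q = ∈outBag⇒producer (subst (p ∈ᵇ_)
          (trans (outBag-producer≡inBag-consumer p)
            (trans (cong (inBag N) (sym consumer-q≡consumer-p)) (sym (outBag-producer≡inBag-consumer q))))
          (producer⇒∈outBag refl))

    inputFree-unique : ∀ {t s} → (∀ p → consumer p ≢ t) → (∀ p → consumer p ≢ s) → t ≡ s
    inputFree-unique {t} {s} t-inputFree s-inputFree with unsnoc (inputFree⇒feedsAll t-inputFree s)
    ... | inj₁ t≡s                              = t≡s
    ... | inj₂ (_ , _ , (q , _ , consumer-q≡s)) = contradiction consumer-q≡s (s-inputFree q)

    inBag-injective : Injective _≡_ _≡_ (inBag N)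
    inBag-injective {t} {s} eq with any? (λ p → consumer p ≟ t)
    ... | yes (p , refl) = ∈inBag⇒consumer (subst (p ∈ᵇ_) eq (consumer⇒∈inBag refl))
    ... | no none = inputFree-unique (λ p → none ∘ (p ,_)) λ p consumer-p≡s →
      none (p , ∈inBag⇒consumer (subst (p ∈ᵇ_) (sym eq) (consumer⇒∈inBag consumer-p≡s)))

    complexes≡transitions : ∀ {c} → Enumeration c → c ≡ nt N
    complexes≡transitions enum =
      enumeration-size enum (inBag N) (λ k → k , inj₁ refl) inBag-injective input-of
      where
      input-of : ∀ x → Vertex x → ∃[ k ] inBag N k ≡ x
      input-of _ (k , inj₁ refl) = k , refl
      input-of _ (k , inj₂ refl) = next k , sym (outBag≡inBag-next k)

    reactionGraph-connected : ∀ {ℓ} → T → Partition (EqClosure Arc) ℓ → ℓ ≡ 1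
    reactionGraph-connected t₀ components = partition-connected components (t₀ , inj₁ refl) reaches
      where
      link : ∀ p → Arc (inBag N (producer p)) (inBag N (consumer p))
      link p = producer p , refl , outBag-producer≡inBag-consumer p
      inputs-linked : ∀ u → EqClosure Arc (inBag N t₀) (inBag N u)
      inputs-linked = placeClosed⇒universal (EqClosure Arc (inBag N t₀) ∘ inBag N)
        (λ p path → path ◅◅ (fwd (link p) ◅ ε)) (λ p path → path ◅◅ (bwd (link p) ◅ ε)) ε
      reaches : ∀ y → Vertex y → EqClosure Arc (inBag N t₀) y
      reaches _ (u , inj₁ refl) = inputs-linked u
      reaches _ (u , inj₂ refl) = inputs-linked u ◅◅ (fwd (arc u) ◅ ε)

  weaklyReversible⇔outputsAreInputs : WeaklyReversible N ⇔ OutputsAreInputs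
  weaklyReversible⇔outputsAreInputs = mk⇔
    (λ reversible t → OnCycle⇒outputIsInput (weaklyReversible⇒everyOnCycle reversible t))
    (λ outputsAreInputs _ _ _ →
      everyOnCycle⇒stronglyConnected (outputsAreInputs⇒everyOnCycle outputsAreInputs))

  ¬outputsAreInputs⇒acyclic : ¬ OutputsAreInputs → Acyclic
  ¬outputsAreInputs⇒acyclic ¬outputsAreInputs t walk = ¬outputsAreInputs λ u →
    OnCycle⇒outputIsInput
      (OnCycle⇒everyOnCycle (undirectedCycle⇒OnCycle emptyBag inBag-unique outBag-unique walk) u)

  incidence-isEdgeRow : ∀ p → IsEdgeRow (incidence N p) (producer p) (consumer p)
  incidence-isEdgeRow p = record
    { off       = λ k k≢s k≢c → entry (singleton-off produced k k≢s) (singleton-off consumed k k≢c)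
    ; at-source = λ s≢c → entry (singleton-at produced) (singleton-off consumed _ s≢c)
    ; at-target = λ s≢c → entry (singleton-off produced _ (s≢c ∘ sym)) (singleton-at consumed)
    ; at-loop   = λ s≡c → entry (singleton-at produced) (trans (cong (pre N p) s≡c) (singleton-at consumed))
    }
    where
    produced : IsSingletonBag (post N p)
    produced = proj₁ (mg p)
    consumed : IsSingletonBag (pre N p)
    consumed = proj₂ (mg p)
    entry : ∀ {k a b} → post N p k ≡ a → pre N p k ≡ b → incidence N p k ≡ (+ a ℤ.- + b) / 1
    entry = cong₂ λ a b → (+ a ℤ.- + b) / 1

  constantAlongPlaces : ∀ (b : T → ℚ) → (∀ p → b (producer p) ≡ b (consumer p)) → ∀ t t′ → b t ≡ b t′
  constantAlongPlaces b along t = placeClosed⇒universal (λ u → b t ≡ b u)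
    (λ p bt≡bs → trans bt≡bs (along p)) (λ p bt≡bc → trans bt≡bc (sym (along p))) refl

deficiency≡ : ∀ {c} ℓ k r → ℓ ℕ.+ (k ℕ.+ r) ≡ c → (+ c ℤ.- + ℓ) ℤ.- + r ≡ + k
deficiency≡ ℓ k r refl = begin
  (+ (ℓ ℕ.+ (k ℕ.+ r)) ℤ.- + ℓ) ℤ.- + r    ≡⟨ cong (λ x → (x ℤ.- + ℓ) ℤ.- + r) (ℤ.pos-+ ℓ (k ℕ.+ r)) ⟩
  (+ ℓ ℤ.+ + (k ℕ.+ r) ℤ.- + ℓ) ℤ.- + r    ≡⟨ cong (λ x → (+ ℓ ℤ.+ x ℤ.- + ℓ) ℤ.- + r) (ℤ.pos-+ k r) ⟩
  (+ ℓ ℤ.+ (+ k ℤ.+ + r) ℤ.- + ℓ) ℤ.- + r  ≡⟨ cancel (+ ℓ) (+ k) (+ r) ⟩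
  + k                                      ∎
  where
  open ≡-Reasoning
  cancel : ∀ x y z → (x ℤ.+ (y ℤ.+ z) ℤ.- x) ℤ.- z ≡ y
  cancel = solve-∀

proposition2 : (N : PetriNet) → MarkedGraph N → Connected N →
    ∀ (δ : ℤ) → Deficiency N δ →
    (δ ≡ + 0 ⊎ δ ≡ + 1) × (δ ≡ + 0 ⇔ WeaklyReversible N)
proposition2 N@record { nt = zero } mg conn δ (c , ℓ , r , enum , components , rank , refl) =
  inj₁ δ≡0 , mk⇔ (λ { _ _ _ (() , _) }) (λ _ → δ≡0)
  where
  open EdgeGraph (inBag N) (outBag N)
  δ≡0 : δ ≡ + 0
  δ≡0 = deficiency≡ ℓ 0 r (trans (cong (ℓ ℕ.+_) (ℕ.n≤0⇒n≡0 (HasRank⇒≤columns {A = incidence N} rank)))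
                                 (acyclic⇒components+arcs≡vertices (λ ()) enum components))
proposition2 N@record { nt = suc n } mg conn δ (c , ℓ , r , enum , components , rank , refl) =
  byOutputsAreInputs outputsAreInputs?
  where
  open ConnectedMarkedGraph N mg conn
  open EdgeGraph (inBag N) (outBag N)
  r≡n : r ≡ n
  r≡n = HasRank-unique {A = incidence N} rank
          (connected-incidence-rank {A = incidence N} incidence-isEdgeRow constantAlongPlaces)
  byOutputsAreInputs : Dec OutputsAreInputs → (δ ≡ + 0 ⊎ δ ≡ + 1) × (δ ≡ + 0 ⇔ WeaklyReversible N)
  byOutputsAreInputs (yes outputsAreInputs) =
    inj₁ δ≡0 , mk⇔ (λ _ → from weaklyReversible⇔outputsAreInputs outputsAreInputs) (λ _ → δ≡0)
    where
    δ≡0 : δ ≡ + 0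
    δ≡0 = deficiency≡ ℓ 0 r (trans (cong₂ ℕ._+_ (reactionGraph-connected outputsAreInputs Fin.zero components) r≡n)
                                   (sym (complexes≡transitions outputsAreInputs enum)))
  byOutputsAreInputs (no ¬outputsAreInputs) = inj₂ δ≡1 , mk⇔ (λ δ≡0 → contradiction (trans (sym δ≡1) δ≡0) λ ())
    (λ reversible → contradiction (to weaklyReversible⇔outputsAreInputs reversible) ¬outputsAreInputs)
    where
    δ≡1 : δ ≡ + 1
    δ≡1 = deficiency≡ ℓ 1 r (trans (cong (λ r → ℓ ℕ.+ suc r) r≡n)
      (acyclic⇒components+arcs≡vertices (¬outputsAreInputs⇒acyclic ¬outputsAreInputs) enum components))
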